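{- There are infinitely many pairwise non-equivalent monotone games over the 5-element linearly ordered atom poset $L_5=\{ -3,-2,-1,0,1\}$ (with its natural order).
   Context: Games over a poset $A$ (whose elements are called atoms) are defined inductively: for each $a\in A$, $[a]$ is a game (atomic game); and whenever $L$ and $R$ are non-empty sets of games, $\{L\mid R\}$ is a game, whose elements of $L$ (resp. $R$) are its left options $G^L$ (resp. right options $G^R$). A position of $G$ is $G$ itself or, recursively, a position of an option of $G$. Relations $\leq$ and $\lhd$ are defined by mutual recursion: $G\leq H$ iff (1) every left option $G^L$ satisfies $G^L\lhd H$, (2) every right option $H^R$ satisfies $G\lhd H^R$, and (3) if $G$ or $H$ is atomic then $G\lhd H$. And $G\lhd H$ iff at least one of: (1) some right option $G^R$ satisfies $G^R\leq H$, (2) some left option $H^L$ satisfies $G\leq H^L$, (3) $G=[a]$, $H=[b]$ are atomic with $a\leq b$. Games $G,H$ are equivalent if $G\leq H$ and $H\leq G$. A game $G$ is locally monotone if every left option satisfies $G\leq G^L$ and every right option satisfies $G^R\leq G$; it is monotone if every position of $G$ is locally monotone. -}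

module Defs where

open import Data.Nat using (ℕ; suc)
open import Data.Fin using (Fin)
open import Data.Integer as ℤ using (ℤ; +_; -[1+_])
open import Data.Product using (Σ; _×_; _,_)
open import Data.Sum using (_⊎_)
open import Relation.Binary.PropositionalEquality using (_≡_)

data Game (A : Set) : Set where
  atom : A → Game A
  node : {m n : ℕ} → (Fin (suc m) → Game A) → (Fin (suc n) → Game A) → Game A

module GameTheory {A : Set} (_≤ₐ_ : A → A → Set) where

  infix 4 _≤G_ _⊲_ _≈G_

  mutual
    -- G ≤ H : (1) all G^L ⊲ H, (2) all H^R with G ⊲ H^R,
    --         (3) if G or H atomic, G ⊲ H.
    _≤G_ : Game A → Game A → Set
    atom a ≤G atom b = atom a ⊲ atom b
    atom a ≤G node L R = (∀ j → atom a ⊲ R j) × (atom a ⊲ node L R)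
    node L R ≤G atom b = (∀ i → L i ⊲ atom b) × (node L R ⊲ atom b)
    node L R ≤G node L′ R′ =
      (∀ i → L i ⊲ node L′ R′) × (∀ j → node L R ⊲ R′ j)

    -- G ⊲ H : (1) some G^R ≤ H, or (2) some H^L with G ≤ H^L,
    --         or (3) G = [a], H = [b] with a ≤ b.
    _⊲_ : Game A → Game A → Set
    atom a ⊲ atom b = a ≤ₐ b
    atom a ⊲ node L R = Σ _ λ j → atom a ≤G L j
    node L R ⊲ atom b = Σ _ λ i → R i ≤G atom b
    node L R ⊲ node L′ R′ =
      (Σ _ λ i → R i ≤G node L′ R′) ⊎ (Σ _ λ j → node L R ≤G L′ j)

  _≈G_ : Game A → Game A → Set
  G ≈G H = (G ≤G H) × (H ≤G G)

  data Position : Game A → Game A → Set where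
    here  : ∀ {G} → Position G G
    left  : ∀ {P m n} {L : Fin (suc m) → Game A} {R : Fin (suc n) → Game A}
            (i : Fin (suc m)) → Position P (L i) → Position P (node L R)
    right : ∀ {P m n} {L : Fin (suc m) → Game A} {R : Fin (suc n) → Game A}
            (j : Fin (suc n)) → Position P (R j) → Position P (node L R)

  LocallyMonotone : Game A → Set
  LocallyMonotone (atom a) = Data.Unit.⊤
    where import Data.Unit
  LocallyMonotone (node L R) = (∀ i → node L R ≤G L i) × (∀ j → R j ≤G node L R)

  Monotone : Game A → Set
  Monotone G = ∀ P → Position P G → LocallyMonotone P

L5 : Set
L5 = Σ ℤ λ z → (ℤ.-[1+ 2 ] ℤ.≤ z) × (z ℤ.≤ ℤ.+ 1)

_≤L5_ : L5 → L5 → Set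
(x , _) ≤L5 (y , _) = x ℤ.≤ y

open GameTheory _≤L5_ public

{-# OPTIONS --safe #-}
module Submission where

-- Write p = {1 | -1} and, for a game G, v G = {G | -3}, u G = {0 | v G},
-- q G = {u G | -3}; put g 0 = {0 | -2} and g (k+1) = {p | q (g k)}. Each
-- local inequality G ≤ Gᴸ, Gᴿ ≤ G needed for monotonicity is checked by hand,
-- the atom -3 being below every game. That g i ≰ g j for i < j is proved
-- together with g i ⋪ q (g j), q (g i) ≰ q (g j), u (g i) ⋪ v (g j) and
-- g i ⋪ v (g j) for suitable i, j: all games involved have a single left and
-- right option, so each of these unfolds to a false comparison of atoms or to
-- another one with smaller indices.

open import Data.Nat using (ℕ; zero; suc; _<_; _≤_; z≤n; s≤s)
open import Data.Nat.Properties using (<-cmp; <⇒≤)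
open import Data.Fin using (zero)
open import Data.Integer as ℤ using (ℤ; +_; -[1+_])
open import Data.Product using (Σ; _×_; _,_; proj₁)
open import Data.Sum using (inj₁; inj₂)
open import Data.Unit using (tt)
open import Data.Empty using (⊥-elim)
open import Relation.Binary using (tri<; tri≈; tri>)
open import Relation.Binary.PropositionalEquality using (_≢_)
open import Relation.Nullary using (¬_)
open import Relation.Nullary.Decidable using (True; False; toWitness; toWitnessFalse)

open import Defs using (Game; atom; node; module GameTheory; L5; _≤L5_)

⟨_∣_⟩ : {A : Set} → Game A → Game A → Game A
⟨ x ∣ y ⟩ = node {m = 0} {n = 0} (λ _ → x) (λ _ → y)

module GameLemmas {A : Set} (_≤ₐ_ : A → A → Set) where
  open GameTheory _≤ₐ_

  ≤-left⇒⊲ : ∀ G x y → G ≤G x → G ⊲ ⟨ x ∣ y ⟩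
  ≤-left⇒⊲ (atom _)   _ _ a≤x = zero , a≤x
  ≤-left⇒⊲ (node _ _) _ _ G≤x = inj₂ (zero , G≤x)

  right-≤⇒⊲ : ∀ x y H → y ≤G H → ⟨ x ∣ y ⟩ ⊲ H
  right-≤⇒⊲ _ _ (atom _)   y≤b = zero , y≤b
  right-≤⇒⊲ _ _ (node _ _) y≤H = inj₁ (zero , y≤H)

  ≤⇒⊲-right : ∀ G x y → G ≤G ⟨ x ∣ y ⟩ → G ⊲ y
  ≤⇒⊲-right (atom _)   _ _ (G⊲y , _) = G⊲y zero
  ≤⇒⊲-right (node _ _) _ _ (_ , G⊲y) = G⊲y zero

  ≤⇒left-⊲ : ∀ x y H → ⟨ x ∣ y ⟩ ≤G H → x ⊲ H
  ≤⇒left-⊲ _ _ (atom _)   (x⊲H , _) = x⊲H zero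
  ≤⇒left-⊲ _ _ (node _ _) (x⊲H , _) = x⊲H zero

  monotone-atom : ∀ a → Monotone (atom a)
  monotone-atom _ _ here = tt

  monotone-⟨∣⟩ : ∀ {x y} → ⟨ x ∣ y ⟩ ≤G x → y ≤G ⟨ x ∣ y ⟩ →
                 Monotone x → Monotone y → Monotone ⟨ x ∣ y ⟩
  monotone-⟨∣⟩ G≤x y≤G _  _  _ here          = (λ _ → G≤x) , (λ _ → y≤G)
  monotone-⟨∣⟩ _   _   mx _  _ (left _ pos)  = mx _ pos
  monotone-⟨∣⟩ _   _   _  my _ (right _ pos) = my _ pos

  pairwise-≉ : (f : ℕ → Game A) → (∀ {i j} → i < j → ¬ f i ≤G f j) →
               ∀ m n → m ≢ n → ¬ f m ≈G f n
  pairwise-≉ f f≰ m n m≢n (fm≤fn , fn≤fm) with <-cmp m n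
  ... | tri< m<n _   _   = f≰ m<n fm≤fn
  ... | tri≈ _   m≡n _   = m≢n m≡n
  ... | tri> _   _   n<m = f≰ n<m fn≤fm

  module _ {⊥ : A} (⊥-least : ∀ a → ⊥ ≤ₐ a) where
    mutual
      atom⊥-≤ : ∀ G → atom ⊥ ≤G G
      atom⊥-≤ (atom a)   = ⊥-least a
      atom⊥-≤ (node L R) = (λ j → atom⊥-⊲ (R j)) , atom⊥-⊲ (node L R)

      atom⊥-⊲ : ∀ G → atom ⊥ ⊲ G
      atom⊥-⊲ (atom a)   = ⊥-least a
      atom⊥-⊲ (node L _) = zero , atom⊥-≤ (L zero)

    ⟨∣atom⊥⟩-⊲ : ∀ x H → ⟨ x ∣ atom ⊥ ⟩ ⊲ H
    ⟨∣atom⊥⟩-⊲ x H = right-≤⇒⊲ x (atom ⊥) H (atom⊥-≤ H)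

open GameTheory _≤L5_
open GameLemmas _≤L5_

mkL5 : (z : ℤ) {lo : True (-[1+ 2 ] ℤ.≤? z)} {hi : True (z ℤ.≤? + 1)} → L5
mkL5 z {lo} {hi} = z , toWitness lo , toWitness hi

ℓ₋₃ ℓ₋₂ ℓ₋₁ ℓ₀ ℓ₁ : L5
ℓ₋₃ = mkL5 -[1+ 2 ]
ℓ₋₂ = mkL5 -[1+ 1 ]
ℓ₋₁ = mkL5 -[1+ 0 ]
ℓ₀  = mkL5 (+ 0)
ℓ₁  = mkL5 (+ 1)

decide≤ : ∀ x y {x≤y : True (proj₁ x ℤ.≤? proj₁ y)} → x ≤L5 y
decide≤ _ _ {x≤y} = toWitness x≤y

decide≰ : ∀ x y {x≰y : False (proj₁ x ℤ.≤? proj₁ y)} → ¬ x ≤L5 y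
decide≰ _ _ {x≰y} = toWitnessFalse x≰y

ℓ₋₃-least : ∀ a → ℓ₋₃ ≤L5 a
ℓ₋₃-least (_ , -3≤a , _) = -3≤a

ℓ₋₃≤ : ∀ G → atom ℓ₋₃ ≤G G
ℓ₋₃≤ = atom⊥-≤ ℓ₋₃-least

⟨∣ℓ₋₃⟩-⊲ : ∀ x H → ⟨ x ∣ atom ℓ₋₃ ⟩ ⊲ H
⟨∣ℓ₋₃⟩-⊲ = ⟨∣atom⊥⟩-⊲ ℓ₋₃-least

p : Game L5
p = ⟨ atom ℓ₁ ∣ atom ℓ₋₁ ⟩

v u q : Game L5 → Game L5
v G = ⟨ G ∣ atom ℓ₋₃ ⟩
u G = ⟨ atom ℓ₀ ∣ v G ⟩
q G = ⟨ u G ∣ atom ℓ₋₃ ⟩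

g : ℕ → Game L5
g zero    = ⟨ atom ℓ₀ ∣ atom ℓ₋₂ ⟩
g (suc k) = ⟨ p ∣ q (g k) ⟩

p≤ℓ₁ : p ≤G atom ℓ₁
p≤ℓ₁ = (λ _ → decide≤ ℓ₁ ℓ₁) , (zero , decide≤ ℓ₋₁ ℓ₁)

ℓ₋₁≤p : atom ℓ₋₁ ≤G p
ℓ₋₁≤p = (λ _ → decide≤ ℓ₋₁ ℓ₋₁) , (zero , decide≤ ℓ₋₁ ℓ₁)

monotone-p : Monotone p
monotone-p = monotone-⟨∣⟩ p≤ℓ₁ ℓ₋₁≤p (monotone-atom ℓ₁) (monotone-atom ℓ₋₁)

g⊲atom : ∀ k a → ℓ₋₂ ≤L5 a → g k ⊲ atom a
g⊲atom zero    a ℓ₋₂≤a = zero , ℓ₋₂≤a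
g⊲atom (suc k) a ℓ₋₂≤a = zero , ((λ _ → zero , v≤a) , ⟨∣ℓ₋₃⟩-⊲ (u (g k)) (atom a))
  where
  v≤a : v (g k) ≤G atom a
  v≤a = (λ _ → g⊲atom k a ℓ₋₂≤a) , ⟨∣ℓ₋₃⟩-⊲ (g k) (atom a)

g⊲ℓ₋₁ : ∀ k → g k ⊲ atom ℓ₋₁
g⊲ℓ₋₁ k = g⊲atom k ℓ₋₁ (decide≤ ℓ₋₂ ℓ₋₁)

g⊲ℓ₀ : ∀ k → g k ⊲ atom ℓ₀
g⊲ℓ₀ k = g⊲atom k ℓ₀ (decide≤ ℓ₋₂ ℓ₀)

g≤ℓ₀ : ∀ k → g k ≤G atom ℓ₀
g≤ℓ₀ zero    = (λ _ → decide≤ ℓ₀ ℓ₀) , g⊲ℓ₀ zero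
g≤ℓ₀ (suc k) = (λ _ → zero , decide≤ ℓ₋₁ ℓ₀) , g⊲ℓ₀ (suc k)

g≤p : ∀ k → g k ≤G p
g≤p zero    = (λ _ → zero , decide≤ ℓ₀ ℓ₁) , (λ _ → g⊲ℓ₋₁ zero)
g≤p (suc k) = (λ _ → ≤-left⇒⊲ p (atom ℓ₁) (atom ℓ₋₁) p≤ℓ₁) , (λ _ → g⊲ℓ₋₁ (suc k))

g⊲g : ∀ k → g k ⊲ g k
g⊲g zero    = ≤-left⇒⊲ (g zero) (atom ℓ₀) (atom ℓ₋₂) (g≤ℓ₀ zero)
g⊲g (suc k) = ≤-left⇒⊲ (g (suc k)) p (q (g k)) (g≤p (suc k))

v≤g : ∀ k → v (g k) ≤G g k
v≤g zero    = (λ _ → g⊲g zero) , (λ _ → ⟨∣ℓ₋₃⟩-⊲ (g zero) (atom ℓ₋₂))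
v≤g (suc k) = (λ _ → g⊲g (suc k)) , (λ _ → ⟨∣ℓ₋₃⟩-⊲ (g (suc k)) (q (g k)))

v≤u : ∀ k → v (g k) ≤G u (g k)
v≤u k = (λ _ → ≤-left⇒⊲ (g k) (atom ℓ₀) (v (g k)) (g≤ℓ₀ k)) , (λ _ → ⟨∣ℓ₋₃⟩-⊲ (g k) (v (g k)))

u≤ℓ₀ : ∀ k → u (g k) ≤G atom ℓ₀
u≤ℓ₀ k = (λ _ → decide≤ ℓ₀ ℓ₀) , (zero , ((λ _ → g⊲ℓ₀ k) , ⟨∣ℓ₋₃⟩-⊲ (g k) (atom ℓ₀)))

q≤u : ∀ k → q (g k) ≤G u (g k)
q≤u k = (λ _ → right-≤⇒⊲ (atom ℓ₀) (v (g k)) (u (g k)) (v≤u k))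
      , (λ _ → ⟨∣ℓ₋₃⟩-⊲ (u (g k)) (v (g k)))

q≤g : ∀ k → q (g k) ≤G g (suc k)
q≤g k = (λ _ → right-≤⇒⊲ (atom ℓ₀) (v (g k)) (g (suc k)) v≤g′)
      , (λ _ → ⟨∣ℓ₋₃⟩-⊲ (u (g k)) (q (g k)))
  where
  v≤g′ : v (g k) ≤G g (suc k)
  v≤g′ = (λ _ → ≤-left⇒⊲ (g k) p (q (g k)) (g≤p k)) , (λ _ → ⟨∣ℓ₋₃⟩-⊲ (g k) (q (g k)))

ℓ₋₂≤g₀ : atom ℓ₋₂ ≤G g zero
ℓ₋₂≤g₀ = (λ _ → decide≤ ℓ₋₂ ℓ₋₂) , (zero , decide≤ ℓ₋₂ ℓ₀)

monotone-g : ∀ k → Monotone (g k)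
monotone-g zero    = monotone-⟨∣⟩ (g≤ℓ₀ zero) ℓ₋₂≤g₀ (monotone-atom ℓ₀) (monotone-atom ℓ₋₂)
monotone-g (suc k) = monotone-⟨∣⟩ (g≤p (suc k)) (q≤g k) monotone-p monotone-q
  where
  monotone-v : Monotone (v (g k))
  monotone-v = monotone-⟨∣⟩ (v≤g k) (ℓ₋₃≤ (v (g k))) (monotone-g k) (monotone-atom ℓ₋₃)

  monotone-u : Monotone (u (g k))
  monotone-u = monotone-⟨∣⟩ (u≤ℓ₀ k) (v≤u k) (monotone-atom ℓ₀) monotone-v

  monotone-q : Monotone (q (g k))
  monotone-q = monotone-⟨∣⟩ (q≤u k) (ℓ₋₃≤ (q (g k))) monotone-u (monotone-atom ℓ₋₃)

ℓ₀⋪g : ∀ k → ¬ atom ℓ₀ ⊲ g (suc k)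
ℓ₀⋪g _ (_ , ℓ₀≤p) = decide≰ ℓ₀ ℓ₋₁ (≤⇒⊲-right (atom ℓ₀) (atom ℓ₁) (atom ℓ₋₁) ℓ₀≤p)

ℓ₋₁≰g : ∀ k → ¬ atom ℓ₋₁ ≤G g k
ℓ₋₁≰g zero    ℓ₋₁≤g₀ = decide≰ ℓ₋₁ ℓ₋₂ (≤⇒⊲-right (atom ℓ₋₁) (atom ℓ₀) (atom ℓ₋₂) ℓ₋₁≤g₀)
ℓ₋₁≰g (suc k) ℓ₋₁≤g′ with ≤⇒⊲-right (atom ℓ₋₁) p (q (g k)) ℓ₋₁≤g′
... | _ , ℓ₋₁≤u with ≤⇒⊲-right (atom ℓ₋₁) (atom ℓ₀) (v (g k)) ℓ₋₁≤u
...   | _ , ℓ₋₁≤g = ℓ₋₁≰g k ℓ₋₁≤g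

p⋪u : ∀ k → ¬ p ⊲ u (g k)
p⋪u k (inj₁ (_ , ℓ₋₁≤u)) with ≤⇒⊲-right (atom ℓ₋₁) (atom ℓ₀) (v (g k)) ℓ₋₁≤u
... | _ , ℓ₋₁≤g = ℓ₋₁≰g k ℓ₋₁≤g
p⋪u k (inj₂ (_ , p≤ℓ₀)) = decide≰ ℓ₁ ℓ₀ (≤⇒left-⊲ (atom ℓ₁) (atom ℓ₋₁) (atom ℓ₀) p≤ℓ₀)

g₀⊲⟨∣ℓ₋₃⟩ : ∀ x → g zero ⊲ ⟨ x ∣ atom ℓ₋₃ ⟩ → g zero ≤G x
g₀⊲⟨∣ℓ₋₃⟩ x (inj₁ (_ , ℓ₋₂≤⟨x∣ℓ₋₃⟩)) =
  ⊥-elim (decide≰ ℓ₋₂ ℓ₋₃ (≤⇒⊲-right (atom ℓ₋₂) x (atom ℓ₋₃) ℓ₋₂≤⟨x∣ℓ₋₃⟩))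
g₀⊲⟨∣ℓ₋₃⟩ _ (inj₂ (_ , g₀≤x)) = g₀≤x

mutual
  g≰g : ∀ {i j} → i < j → ¬ g i ≤G g j
  g≰g {zero}  {suc j}       _           g₀≤g = ℓ₀⋪g j (≤⇒left-⊲ (atom ℓ₀) (atom ℓ₋₂) (g (suc j)) g₀≤g)
  g≰g {suc i} {suc (suc j)} (s≤s i<1+j) g≤g  = g⋪q i<1+j (≤⇒⊲-right (g (suc i)) p (q (g (suc j))) g≤g)

  g⋪q : ∀ {i j} → i ≤ suc j → ¬ g i ⊲ q (g (suc j))
  g⋪q {zero} {j} _ g₀⊲q = g≰g {j = suc j} (s≤s z≤n) g₀≤g
    where
    g₀≤u : g zero ≤G u (g (suc j))
    g₀≤u = g₀⊲⟨∣ℓ₋₃⟩ (u (g (suc j))) g₀⊲q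

    g₀≤g : g zero ≤G g (suc j)
    g₀≤g = g₀⊲⟨∣ℓ₋₃⟩ (g (suc j)) (≤⇒⊲-right (g zero) (atom ℓ₀) (v (g (suc j))) g₀≤u)
  g⋪q {suc i} i<1+j (inj₁ (_ , q≤q)) = q≰q i<1+j q≤q
  g⋪q {suc i} {j} _ (inj₂ (_ , g≤u)) = p⋪u (suc j) (≤⇒left-⊲ p (q (g i)) (u (g (suc j))) g≤u)

  q≰q : ∀ {i j} → i < j → ¬ q (g i) ≤G q (g j)
  q≰q {i} {suc j} i<1+j q≤q with ≤⇒left-⊲ (u (g i)) (atom ℓ₋₃) (q (g (suc j))) q≤q
  ... | inj₁ (_ , v≤q) = g⋪q (<⇒≤ i<1+j) (≤⇒left-⊲ (g i) (atom ℓ₋₃) (q (g (suc j))) v≤q)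
  ... | inj₂ (_ , u≤u) = u⋪v i<1+j (≤⇒⊲-right (u (g i)) (atom ℓ₀) (v (g (suc j))) u≤u)

  u⋪v : ∀ {i j} → i < j → ¬ u (g i) ⊲ v (g j)
  u⋪v {i} {j} i<j (inj₁ (_ , v≤v)) = g⋪v i<j (≤⇒left-⊲ (g i) (atom ℓ₋₃) (v (g j)) v≤v)
  u⋪v {i} {suc j} _ (inj₂ (_ , u≤g)) = ℓ₀⋪g j (≤⇒left-⊲ (atom ℓ₀) (v (g i)) (g (suc j)) u≤g)

  g⋪v : ∀ {i j} → i < j → ¬ g i ⊲ v (g j)
  g⋪v {zero}  {j} i<j g₀⊲v = g≰g i<j (g₀⊲⟨∣ℓ₋₃⟩ (g j) g₀⊲v)
  g⋪v {suc i} {j} i<j (inj₁ (_ , q≤v)) = u⋪v (<⇒≤ i<j) (≤⇒left-⊲ (u (g i)) (atom ℓ₋₃) (v (g j)) q≤v)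
  g⋪v {suc i} i<j (inj₂ (_ , g≤g)) = g≰g i<j g≤g

corollary5 : Σ (ℕ → Game L5) λ f →
               ((n : ℕ) → Monotone (f n)) ×
               ((m n : ℕ) → m ≢ n → ¬ (f m ≈G f n))
corollary5 = g , monotone-g , pairwise-≉ g g≰g
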